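{- Let $t$ be the Thue–Morse word and let $\theta$ be the morphism $0\mapsto0110,\ 1\mapsto1001$. Let $w,u$ be factors of $t$ with $|w|\ge|u|\ge2$. Then the number of occurrences of $\theta(u)$ in $\theta(w)$ equals the number of occurrences of $u$ in $w$.
   Context: The Thue–Morse word $t$ is the fixed point beginning with $0$ of the morphism $0\mapsto01,\ 1\mapsto10$ (equivalently of its square $\theta$). An occurrence of $u$ in $w$ is a position $i$ with $w[i,i+|u|-1]=u$. -}

module Defs where

open import Data.Bool using (Bool; true; false; not)
open import Data.Nat using (ℕ; zero; suc; _+_; _∸_)
open import Data.List using (List; []; _∷_; _++_; concatMap; length; take; drop; map; upTo; lookup; filter)
open import Data.List.Properties using (≡-dec)
open import Data.Bool.Properties using () renaming (_≟_ to _≟B_)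
open import Data.Maybe using (Maybe; just; nothing)
open import Data.Product using (∃)
open import Relation.Binary.PropositionalEquality using (_≡_)

-- Letters: false = 0, true = 1.
Word : Set
Word = List Bool

μ : Word → Word
μ = concatMap (λ a → a ∷ not a ∷ [])

θ : Word → Word
θ = concatMap (λ a → a ∷ not a ∷ not a ∷ a ∷ [])

μ^ : ℕ → Word
μ^ zero = false ∷ []
μ^ (suc n) = μ (μ^ n)

at : Word → ℕ → Bool
at [] _ = false
at (a ∷ _) zero = a
at (_ ∷ as) (suc i) = at as i

-- The Thue–Morse word t (fixed point of μ starting with 0): its i-th letter
-- is the i-th letter of μ^(i+1)(0), a prefix of t of length 2^(i+1) > i.
tm : ℕ → Bool
tm i = at (μ^ (suc i)) i

tmFactorAt : ℕ → ℕ → Word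
tmFactorAt i zero = []
tmFactorAt i (suc n) = tm i ∷ tmFactorAt (suc i) n

IsFactorOfT : Word → Set
IsFactorOfT u = ∃ λ i → tmFactorAt i (length u) ≡ u

slice : Word → ℕ → ℕ → Word
slice w i n = take n (drop i w)

-- number of occurrences of u in w: positions i (0 ≤ i ≤ |w| - |u|, with |u| ≤ |w|
-- implicit: slices of the wrong length never equal u) with w[i, i+|u|-1] = u.
occurrences : Word → Word → ℕ
occurrences u w =
  length (filter (λ i → ≡-dec _≟B_ (slice w i (length u)) u) (upTo (suc (length w))))

-- An occurrence of θ(u) with |u| ≥ 2 begins with b b̄ b̄ b c c̄ c̄ c. Read inside θ(w) from an offset
-- that is 1 or 3 modulo 4 this is impossible outright, and from offset 2 it forces three equal
-- consecutive letters of w, which a factor of t cannot have since t(2k+1) = not t(2k). So every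
-- occurrence of θ(u) is aligned with the 4-blocks, and since θ is injective and 4-uniform the aligned
-- occurrences are exactly the images of the occurrences of u.

module Submission where

open import Defs
open import Data.Nat using (zero; suc; _+_; _≤_; _<_; z≤n; s≤s; z<s)
open import Data.Nat.Properties using (≤-trans; m≤m+n; m<m+n; m≤n⇒m≤1+n; +-suc)
open import Data.Bool using (true; false; not)
open import Data.Bool.Properties using (not-¬) renaming (_≟_ to _≟B_)
open import Data.List using ([]; _∷_; _++_; length; take; drop; map; filter; upTo; applyUpTo)
open import Data.List.Properties using (≡-dec; length-++; map-upTo; filter-accept; filter-reject)
open import Data.Product using (_×_; _,_; ∃; ∃₂)
open import Data.Sum using (_⊎_; inj₁; inj₂)
open import Data.Unit using (⊤; tt)
open import Relation.Nullary using (¬_; Dec; yes; no; does)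
open import Relation.Unary using (Decidable)
open import Function.Bundles using (_⇔_; mk⇔; Equivalence)
open import Relation.Binary.PropositionalEquality
  using (_≡_; refl; sym; trans; cong; cong₂; subst; module ≡-Reasoning)

letterAt : ∀ {v v′ : Word} → v ≡ v′ → ∀ i → at v i ≡ at v′ i
letterAt eq i = cong (λ v → at v i) eq

at-++ˡ : ∀ x y {i} → i < length x → at (x ++ y) i ≡ at x i
at-++ˡ (a ∷ x) y {zero}  _         = refl
at-++ˡ (a ∷ x) y {suc i} (s≤s i<) = at-++ˡ x y i<

μ-++ : ∀ x y → μ (x ++ y) ≡ μ x ++ μ y
μ-++ []      y = refl
μ-++ (a ∷ x) y = cong (λ z → a ∷ not a ∷ z) (μ-++ x y)

at-μ-even : ∀ x k → at (μ x) (k + k) ≡ at x k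
at-μ-even []      k       = refl
at-μ-even (a ∷ x) zero    = refl
at-μ-even (a ∷ x) (suc k) rewrite +-suc k k = at-μ-even x k

at-μ-odd : ∀ x k → k < length x → at (μ x) (suc (k + k)) ≡ not (at x k)
at-μ-odd (a ∷ x) zero    _         = refl
at-μ-odd (a ∷ x) (suc k) (s≤s k<) rewrite +-suc k k = at-μ-odd x k k<

μ^-suc-extends : ∀ n → ∃₂ λ b s → μ^ (suc n) ≡ μ^ n ++ b ∷ s
μ^-suc-extends zero = _ , [] , refl
μ^-suc-extends (suc n) with μ^-suc-extends n
... | b , s , eq = b , not b ∷ μ s , trans (cong μ eq) (μ-++ (μ^ n) (b ∷ s))

n<length-μ^ : ∀ n → n < length (μ^ n)
n<length-μ^ zero    = s≤s z≤n
n<length-μ^ (suc n) with μ^-suc-extends n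
... | b , s , eq rewrite eq | length-++ (μ^ n) {b ∷ s} =
  ≤-trans (s≤s (n<length-μ^ n)) (m<m+n (length (μ^ n)) z<s)

at-μ^-suc : ∀ n {i} → i < length (μ^ n) → at (μ^ (suc n)) i ≡ at (μ^ n) i
at-μ^-suc n i< with μ^-suc-extends n
... | b , s , eq rewrite eq = at-++ˡ (μ^ n) (b ∷ s) i<

tm-odd : ∀ k → tm (suc (k + k)) ≡ not (tm (k + k))
tm-odd k = begin
  at (μ (μ^ (suc (k + k)))) (suc (k + k)) ≡⟨ at-μ-odd (μ^ (suc (k + k))) k k<length-μ^-suc ⟩
  not (at (μ^ (suc (k + k))) k)           ≡⟨ cong not (at-μ^-suc (k + k) k<length-μ^) ⟩
  not (at (μ^ (k + k)) k)                 ≡⟨ cong not (at-μ-even (μ^ (k + k)) k) ⟨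
  not (at (μ (μ^ (k + k))) (k + k))       ∎
  where
  open ≡-Reasoning
  k<length-μ^ : k < length (μ^ (k + k))
  k<length-μ^ = ≤-trans (s≤s (m≤m+n k k)) (n<length-μ^ (k + k))
  k<length-μ^-suc : k < length (μ^ (suc (k + k)))
  k<length-μ^-suc = ≤-trans (s≤s (m≤n⇒m≤1+n (m≤m+n k k))) (n<length-μ^ (suc (k + k)))

even-or-odd : ∀ i → ∃ λ k → i ≡ k + k ⊎ suc i ≡ k + k
even-or-odd zero = zero , inj₁ refl
even-or-odd (suc i) with even-or-odd i
... | k , inj₁ i≡2k  = suc k , inj₂ (cong suc (trans (cong suc i≡2k) (sym (+-suc k k))))
... | k , inj₂ 1+i≡2k = k , inj₁ 1+i≡2k

tm-noLetterCube : ∀ i → ¬ (tm i ≡ tm (suc i) × tm (suc i) ≡ tm (suc (suc i)))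
tm-noLetterCube i with even-or-odd i
... | k , inj₁ refl  = λ (e , _) → not-¬ refl (trans e (tm-odd k))
... | k , inj₂ 1+i≡2k = λ (_ , e) →
  not-¬ refl (trans (subst (λ j → tm j ≡ tm (suc j)) 1+i≡2k e) (tm-odd k))

LetterCubeFree : Word → Set
LetterCubeFree (a ∷ b ∷ c ∷ w) = ¬ (a ≡ b × b ≡ c) × LetterCubeFree (b ∷ c ∷ w)
LetterCubeFree _ = ⊤

LetterCubeFree-tail : ∀ a w → LetterCubeFree (a ∷ w) → LetterCubeFree w
LetterCubeFree-tail a []          _        = tt
LetterCubeFree-tail a (b ∷ [])    _        = tt
LetterCubeFree-tail a (b ∷ c ∷ w) (_ , cf) = cf

tmFactorAt-letterCubeFree : ∀ i n → LetterCubeFree (tmFactorAt i n)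
tmFactorAt-letterCubeFree i zero                = tt
tmFactorAt-letterCubeFree i (suc zero)          = tt
tmFactorAt-letterCubeFree i (suc (suc zero))    = tt
tmFactorAt-letterCubeFree i (suc (suc (suc n))) =
  tm-noLetterCube i , tmFactorAt-letterCubeFree (suc i) (suc (suc n))

length-filter-map : ∀ {A B : Set} {P : B → Set} (P? : Decidable P) (f : A → B) xs →
                    length (filter P? (map f xs)) ≡ length (filter (λ x → P? (f x)) xs)
length-filter-map P? f []       = refl
length-filter-map P? f (x ∷ xs) with does (P? (f x))
... | true  = cong suc (length-filter-map P? f xs)
... | false = length-filter-map P? f xs

IsPrefix : Word → Word → Set
IsPrefix u v = take (length u) v ≡ u

occursAt? : (u w : Word) → Decidable (λ i → IsPrefix u (drop i w))
occursAt? u w i = ≡-dec _≟B_ (slice w i (length u)) u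

occurrences-skipHead : ∀ u a w →
  length (filter (occursAt? u (a ∷ w)) (applyUpTo suc (suc (length w)))) ≡ occurrences u w
occurrences-skipHead u a w = begin
  length (filter (occursAt? u (a ∷ w)) (applyUpTo suc (suc (length w))))
    ≡⟨ cong (λ is → length (filter (occursAt? u (a ∷ w)) is)) (map-upTo suc (suc (length w))) ⟨
  length (filter (occursAt? u (a ∷ w)) (map suc (upTo (suc (length w)))))
    ≡⟨ length-filter-map (occursAt? u (a ∷ w)) suc (upTo (suc (length w))) ⟩
  occurrences u w ∎
  where open ≡-Reasoning

occurrences-∷-accept : ∀ u a w → IsPrefix u (a ∷ w) → occurrences u (a ∷ w) ≡ suc (occurrences u w)
occurrences-∷-accept u a w p =
  trans (cong length (filter-accept (occursAt? u (a ∷ w)) p)) (cong suc (occurrences-skipHead u a w))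

occurrences-∷-reject : ∀ u a w → ¬ IsPrefix u (a ∷ w) → occurrences u (a ∷ w) ≡ occurrences u w
occurrences-∷-reject u a w ¬p =
  trans (cong length (filter-reject (occursAt? u (a ∷ w)) ¬p)) (occurrences-skipHead u a w)

θ-injective : ∀ x y → θ x ≡ θ y → x ≡ y
θ-injective []      []      _  = refl
θ-injective []      (b ∷ y) ()
θ-injective (a ∷ x) []      ()
θ-injective (a ∷ x) (b ∷ y) eq = cong₂ _∷_ (letterAt eq 0) (θ-injective x y (cong (drop 4) eq))

take-θ : ∀ u v → take (length (θ u)) (θ v) ≡ θ (take (length u) v)
take-θ []      v       = refl
take-θ (b ∷ u) []      = refl
take-θ (b ∷ u) (a ∷ v) = cong (λ z → a ∷ not a ∷ not a ∷ a ∷ z) (take-θ u v)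

θ-isPrefix⇔ : ∀ u v → IsPrefix (θ u) (θ v) ⇔ IsPrefix u v
θ-isPrefix⇔ u v = mk⇔ (λ p → θ-injective _ _ (trans (sym (take-θ u v)) p))
                      (λ p → trans (take-θ u v) (cong θ p))

θ-misaligned₁ : ∀ a w b c u → ¬ IsPrefix (θ (b ∷ c ∷ u)) (drop 1 (θ (a ∷ w)))
θ-misaligned₁ a w b c u eq = not-¬ (letterAt eq 0) (letterAt eq 1)

θ-misaligned₂ : ∀ a w b c u → LetterCubeFree (a ∷ w) → ¬ IsPrefix (θ (b ∷ c ∷ u)) (drop 2 (θ (a ∷ w)))
θ-misaligned₂ a []            b c u _            ()
θ-misaligned₂ a (a′ ∷ [])     b c u _            ()
θ-misaligned₂ a (a′ ∷ a″ ∷ w) b c u (noCube , _) eq =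
  noCube (trans (letterAt eq 1) (sym (letterAt eq 2)) , trans (letterAt eq 5) (sym (letterAt eq 6)))

θ-misaligned₃ : ∀ a w b c u → ¬ IsPrefix (θ (b ∷ c ∷ u)) (drop 3 (θ (a ∷ w)))
θ-misaligned₃ a []       b c u ()
θ-misaligned₃ a (a′ ∷ w) b c u eq = not-¬ refl (trans (letterAt eq 1) (sym (letterAt eq 2)))

occurrences-∷-cong : ∀ {u a w u′ a′ w′} → IsPrefix u (a ∷ w) ⇔ IsPrefix u′ (a′ ∷ w′) →
                     occurrences u w ≡ occurrences u′ w′ → occurrences u (a ∷ w) ≡ occurrences u′ (a′ ∷ w′)
occurrences-∷-cong {u} {a} {w} {u′} {a′} {w′} p⇔p′ eq = byPrefix (occursAt? u (a ∷ w) 0)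
  where
  byPrefix : Dec (IsPrefix u (a ∷ w)) → occurrences u (a ∷ w) ≡ occurrences u′ (a′ ∷ w′)
  byPrefix (yes p) = trans (occurrences-∷-accept u a w p)
    (trans (cong suc eq) (sym (occurrences-∷-accept u′ a′ w′ (Equivalence.to p⇔p′ p))))
  byPrefix (no ¬p) = trans (occurrences-∷-reject u a w ¬p)
    (trans eq (sym (occurrences-∷-reject u′ a′ w′ (λ p′ → ¬p (Equivalence.from p⇔p′ p′)))))

occurrences-θ-skipBlock : ∀ a w b c u → LetterCubeFree (a ∷ w) →
  occurrences (θ (b ∷ c ∷ u)) (drop 1 (θ (a ∷ w))) ≡ occurrences (θ (b ∷ c ∷ u)) (θ w)
occurrences-θ-skipBlock a w b c u cf = begin
  occurrences θu (drop 1 (θ (a ∷ w))) ≡⟨ occurrences-∷-reject θu _ _ (θ-misaligned₁ a w b c u) ⟩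
  occurrences θu (drop 2 (θ (a ∷ w))) ≡⟨ occurrences-∷-reject θu _ _ (θ-misaligned₂ a w b c u cf) ⟩
  occurrences θu (drop 3 (θ (a ∷ w))) ≡⟨ occurrences-∷-reject θu _ _ (θ-misaligned₃ a w b c u) ⟩
  occurrences θu (θ w)                ∎
  where
  open ≡-Reasoning
  θu : Word
  θu = θ (b ∷ c ∷ u)

occurrences-θ : ∀ b c u w → LetterCubeFree w →
                occurrences (θ (b ∷ c ∷ u)) (θ w) ≡ occurrences (b ∷ c ∷ u) w
occurrences-θ b c u []      _  = refl
occurrences-θ b c u (a ∷ w) cf =
  occurrences-∷-cong (θ-isPrefix⇔ (b ∷ c ∷ u) (a ∷ w))
    (trans (occurrences-θ-skipBlock a w b c u cf) (occurrences-θ b c u w (LetterCubeFree-tail a w cf)))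

proposition4p3 : ∀ (w u : Word) → IsFactorOfT w → IsFactorOfT u →
                 length u ≤ length w → 2 ≤ length u →
                 occurrences (θ u) (θ w) ≡ occurrences u w
proposition4p3 w []          _           _ _ ()
proposition4p3 w (b ∷ [])    _           _ _ (s≤s ())
proposition4p3 w (b ∷ c ∷ u) (i , tmᵢ≡w) _ _ _ =
  occurrences-θ b c u w (subst LetterCubeFree tmᵢ≡w (tmFactorAt-letterCubeFree i (length w)))
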